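{- Let $\vdash$ be a finitary logic satisfying the standing assumption below, and suppose $\vdash$ has no antitheorems. Then: (i) for any finite (possibly empty) sequences $\bullet,\bullet'$ over $\{l,r\}$, if $\Gamma\vdash^{\bullet rl\bullet'}\varphi$, then there exists $\Delta\subseteq\Gamma$ such that $\Delta\vdash\varphi$ and $\mathrm{Var}(\Delta)=\mathrm{Var}(\varphi)$; (ii) $\vdash^{rl}\leq\vdash^{\bullet}$ for every finite (possibly empty) sequence $\bullet$ over $\{l,r\}$.
   Context: Fix an algebraic language and let $Fm$ be the set of formulas built over a countably infinite set $\mathrm{Var}$ of variables. For a formula $\varphi$, $\mathrm{Var}(\varphi)$ is the set of variables occurring in $\varphi$, and for $\Gamma\subseteq Fm$, $\mathrm{Var}(\Gamma)=\bigcup_{\gamma\in\Gamma}\mathrm{Var}(\gamma)$. A logic is a consequence relation $\vdash\subseteq\mathcal{P}(Fm)\times Fm$ invariant under substitutions; it is finitary if $\Gamma\vdash\varphi$ iff $\Delta\vdash\varphi$ for some finite $\Delta\subseteq\Gamma$. For logics $\vdash',\vdash''$ in the same language, $\vdash'\leq\vdash''$ means that $\Gamma\vdash'\varphi$ implies $\Gamma\vdash''\varphi$. A set $\Sigma$ of formulas is an antitheorem of $\vdash$ if $\sigma[\Sigma]\vdash\varphi$ for every substitution $\sigma$ and every formula $\varphi$. For a logic $\vdash$: $\Gamma\vdash^{l}\varphi$ iff there is $\Delta\subseteq\Gamma$ with $\mathrm{Var}(\Delta)\subseteq\mathrm{Var}(\varphi)$ and $\Delta\vdash\varphi$; $\Gamma\vdash^{r}\varphi$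 iff either ($\Gamma\vdash\varphi$ and $\mathrm{Var}(\varphi)\subseteq\mathrm{Var}(\Gamma)$) or $\Sigma\subseteq\Gamma$ for some antitheorem $\Sigma$ of $\vdash$. For a finite sequence $u_1\dots u_n$ over $\{l,r\}$, $\vdash^{u_1\dots u_n}$ is the result of applying the operation $u_n$ to $\vdash^{u_1\dots u_{n-1}}$ (the empty sequence gives $\vdash$); juxtaposition denotes concatenation of sequences. Standing assumption: $\vdash$ is finitary and there is a binary formula $\pi(x,y)$, in which $x$ and $y$ really occur, that is an $l$-partition function for $\vdash^l$ and an $r$-partition function for $\vdash^r$. Here: for a logic $\vdash'$, $\mathrm{Alg}(\vdash')$ is the class of algebraic reducts of the reduced matrix models of $\vdash'$; a binary operation $\cdot$ on an algebra is a partition function if for all $a,b,c$ and every basic operation $g$ of arity $n\ge1$: $a\cdot a=a$; $a\cdot(b\cdot c)=(a\cdot b)\cdot c$; $a\cdot(b\cdot c)=a\cdot(c\cdot b)$; $g(a_1,\dots,a_n)\cdot b=g(a_1\cdot b,\dots,a_n\cdot b)$; $b\cdot g(a_1,\dots,a_n)=b\cdot a_1\cdot\ldots\cdot a_n$. A formula $x\cdot y$ is an $l$-partition function for $\vdash'$ if $x\vdash' x\cdot y$ and these five conditions hold as equations in every algebra of $\mathrm{Alg}(\vdash')$; a formula $x\ast y$ is an $r$-partition function for $\vdash'$ if $x,y\vdash' x\ast y$, $x\ast y\vdash' x$, and $\ast$ is a partition function in every algebra of $\mathrm{Alg}(\vdash')$. -}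

module Defs where

open import Level using (0ℓ)
open import Data.Nat using (ℕ; zero; suc; _≟_)
open import Data.Fin using (Fin)
open import Data.List using (List)
open import Data.List.Membership.Propositional using (_∈_)
open import Data.Product using (Σ; ∃; _×_; _,_)
open import Data.Bool using (if_then_else_)
open import Relation.Nullary using (¬_; does)
open import Relation.Unary using (Pred; _⊆_)
open import Relation.Binary.PropositionalEquality using (_≡_)

record Signature : Set₁ where
  field
    Op : Set
    ar : Op → ℕ

module _ (S : Signature) where
  open Signature S

  data Fm : Set where
    var : ℕ → Fm
    op  : (o : Op) → (Fin (ar o) → Fm) → Fm

  data _occursIn_ (x : ℕ) : Fm → Set where
    here  : x occursIn var x
    there : ∀ {o} {args : Fin (ar o) → Fm} (i : Fin (ar o)) →
            x occursIn args i → x occursIn op o args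

  VarSet : Pred Fm 0ℓ → Pred ℕ 0ℓ
  VarSet Γ x = ∃ λ γ → Γ γ × x occursIn γ

  VarFm : Fm → Pred ℕ 0ℓ
  VarFm φ x = x occursIn φ

  Subst : Set
  Subst = ℕ → Fm

  sub : Subst → Fm → Fm
  sub σ (var x) = σ x
  sub σ (op o args) = op o (λ i → sub σ (args i))

  image : Subst → Pred Fm 0ℓ → Pred Fm 0ℓ
  image σ Γ ψ = ∃ λ γ → Γ γ × sub σ γ ≡ ψ

  CRel : Set₂
  CRel = Pred Fm 0ℓ → Fm → Set₁

  listSet : List Fm → Pred Fm 0ℓ
  listSet Δ φ = φ ∈ Δ

  record IsLogic (_⊢_ : CRel) : Set₁ where
    field
      reflexive  : ∀ {Γ φ} → Γ φ → Γ ⊢ φ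
      monotone   : ∀ {Γ Δ φ} → Γ ⊆ Δ → Γ ⊢ φ → Δ ⊢ φ
      cut        : ∀ {Γ Δ φ} → (∀ δ → Δ δ → Γ ⊢ δ) → Δ ⊢ φ → Γ ⊢ φ
      structural : ∀ {Γ φ} (σ : Subst) → Γ ⊢ φ → image σ Γ ⊢ sub σ φ

  Finitary : CRel → Set₁
  Finitary _⊢_ = ∀ Γ φ →
    (Γ ⊢ φ → Σ (List Fm) λ Δ → listSet Δ ⊆ Γ × listSet Δ ⊢ φ) ×
    ((Σ (List Fm) λ Δ → listSet Δ ⊆ Γ × listSet Δ ⊢ φ) → Γ ⊢ φ)

  _≤L_ : CRel → CRel → Set₁
  ⊢₁ ≤L ⊢₂ = ∀ Γ φ → ⊢₁ Γ φ → ⊢₂ Γ φ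

  IsAntitheorem : CRel → Pred Fm 0ℓ → Set₁
  IsAntitheorem _⊢_ Σ' = ∀ (σ : Subst) φ → image σ Σ' ⊢ φ

  lOp : CRel → CRel
  lOp _⊢_ Γ φ = Σ (Pred Fm 0ℓ) λ Δ → Δ ⊆ Γ × VarSet Δ ⊆ VarFm φ × Δ ⊢ φ

  rOp : CRel → CRel
  rOp _⊢_ Γ φ =
    (Γ ⊢ φ × VarFm φ ⊆ VarSet Γ) ⊎' (Σ (Pred Fm 0ℓ) λ Σ' → IsAntitheorem _⊢_ Σ' × Σ' ⊆ Γ)
    where
      open import Data.Sum using () renaming (_⊎_ to _⊎'_)

  data LR : Set where
    l r : LR

  applyLR : LR → CRel → CRel
  applyLR l = lOp
  applyLR r = rOp

  -- ⊢^{u₁…uₙ}: apply u₁ first, then u₂, …, then uₙ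
  iter : CRel → List LR → CRel
  iter ⊢ List.[] = ⊢
  iter ⊢ (u List.∷ us) = iter (applyLR u ⊢) us

  record Algebra : Set₁ where
    field
      Carrier : Set
      interp  : (o : Op) → (Fin (ar o) → Carrier) → Carrier

  module _ (A : Algebra) where
    open Algebra A

    eval : (ℕ → Carrier) → Fm → Carrier
    eval h (var x) = h x
    eval h (op o args) = interp o (λ i → eval h (args i))

    IsMatrixModel : CRel → Pred Carrier 0ℓ → Set₁
    IsMatrixModel _⊢_ F = ∀ Γ φ (h : ℕ → Carrier) → Γ ⊢ φ →
      (∀ γ → Γ γ → F (eval h γ)) → F (eval h φ)

    record IsCongruence (θ : Carrier → Carrier → Set) : Set where
      field
        refl′  : ∀ a → θ a a
        sym′   : ∀ {a b} → θ a b → θ b a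
        trans′ : ∀ {a b c} → θ a b → θ b c → θ a c
        compat : ∀ o (as bs : Fin (ar o) → Carrier) →
                 (∀ i → θ (as i) (bs i)) → θ (interp o as) (interp o bs)

    Compatible : (Carrier → Carrier → Set) → Pred Carrier 0ℓ → Set
    Compatible θ F = ∀ {a b} → θ a b → F a → F b

    -- ⟨A,F⟩ is reduced: its Leibniz congruence (the largest congruence
    -- compatible with F) is the identity relation
    IsReduced : Pred Carrier 0ℓ → Set₁
    IsReduced F = ∀ (θ : Carrier → Carrier → Set) → IsCongruence θ →
      Compatible θ F → ∀ a b → θ a b → a ≡ b

    binop : Fm → ℕ → Carrier → Carrier → Carrier
    binop π x a b = eval (λ z → if does (z ≟ x) then a else b) π

    chain : ∀ {n} → (Carrier → Carrier → Carrier) → Carrier → (Fin n → Carrier) → Carrier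
    chain {zero}  _·_ b as = b
    chain {suc n} _·_ b as = chain _·_ (b · as Fin.zero) (λ i → as (Fin.suc i))

    IsPartitionFunction : (Carrier → Carrier → Carrier) → Set
    IsPartitionFunction _·_ =
      (∀ a → (a · a) ≡ a) ×
      (∀ a b c → (a · (b · c)) ≡ ((a · b) · c)) ×
      (∀ a b c → (a · (b · c)) ≡ (a · (c · b))) ×
      (∀ (o : Op) {n} → ar o ≡ suc n → ∀ (as : Fin (ar o) → Carrier) b →
          (interp o as · b) ≡ interp o (λ i → as i · b)) ×
      (∀ (o : Op) {n} → ar o ≡ suc n → ∀ (as : Fin (ar o) → Carrier) b →
          (b · interp o as) ≡ chain _·_ b as)

  InAlg : CRel → Algebra → Set₁
  InAlg ⊢ A = Σ (Pred (Algebra.Carrier A) 0ℓ) λ F →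
    IsMatrixModel A ⊢ F × IsReduced A F

  singleton : Fm → Pred Fm 0ℓ
  singleton φ ψ = ψ ≡ φ

  pair : Fm → Fm → Pred Fm 0ℓ
  pair φ φ' ψ = (ψ ≡ φ) ⊎' (ψ ≡ φ')
    where open import Data.Sum using () renaming (_⊎_ to _⊎'_)

  IsLPartition : CRel → Fm → ℕ → Set₁
  IsLPartition ⊢ π x =
    ⊢ (singleton (var x)) π ×
    (∀ A → InAlg ⊢ A → IsPartitionFunction A (binop A π x))

  IsRPartition : CRel → Fm → ℕ → ℕ → Set₁
  IsRPartition ⊢ π x y =
    ⊢ (pair (var x) (var y)) π ×
    ⊢ (singleton π) (var x) ×
    (∀ A → InAlg ⊢ A → IsPartitionFunction A (binop A π x))

  IsBinaryFormula : Fm → ℕ → ℕ → Set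
  IsBinaryFormula π x y =
    ¬ (x ≡ y) × x occursIn π × y occursIn π ×
    (∀ z → z occursIn π → (z ≡ x) ⊎' (z ≡ y))
    where open import Data.Sum using () renaming (_⊎_ to _⊎'_)

  StandingAssumption : CRel → Set₁
  StandingAssumption ⊢ =
    Finitary ⊢ ×
    Σ Fm λ π → Σ ℕ λ x → Σ ℕ λ y →
      IsBinaryFormula π x y × IsLPartition (lOp ⊢) π x × IsRPartition (rOp ⊢) π x y

-- Without antitheorems the second clause of r never applies, so l and r only
-- remove consequences: every ⊢^• lies below ⊢. A derivation of ⊢^{rl} comes from
-- premises Δ with Var(Δ) ⊆ Var(φ) (by l) and Var(φ) ⊆ Var(Δ) (by r). Such
-- variable-exact derivations by ⊢ are stable: whatever lies below them stays
-- below them after l or r, and they themselves survive l and r.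
module Submission where

open import Defs
open import Level using (0ℓ)
open import Data.List using (List; []; _∷_; _++_)
open import Data.Product using (Σ; _×_; _,_)
open import Data.Sum using (inj₁; inj₂)
open import Data.Empty using (⊥-elim)
open import Function using (id; _∘_)
open import Relation.Nullary using (¬_)
open import Relation.Unary using (Pred; _⊆_)
open import Relation.Binary.PropositionalEquality using (_≡_; refl; subst)

module _ (S : Signature) where

  Monotone : CRel S → Set₁
  Monotone ⊢ = ∀ {Γ Δ φ} → Γ ⊆ Δ → ⊢ Γ φ → ⊢ Δ φ

  NoAntitheorem : CRel S → Set₁
  NoAntitheorem ⊢ = ¬ (Σ (Pred (Fm S) 0ℓ) λ Σ' → IsAntitheorem S ⊢ Σ')

  varExact : CRel S → CRel S
  varExact ⊢ Γ φ = Σ (Pred (Fm S) 0ℓ) λ Δ → Δ ⊆ Γ × ⊢ Δ φ ×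
    VarSet S Δ ⊆ VarFm S φ × VarFm S φ ⊆ VarSet S Δ

  ≤L-refl : ∀ {⊢} → _≤L_ S ⊢ ⊢
  ≤L-refl _ _ = id

  ≤L-trans : ∀ {⊢₁ ⊢₂ ⊢₃} → _≤L_ S ⊢₁ ⊢₂ → _≤L_ S ⊢₂ ⊢₃ → _≤L_ S ⊢₁ ⊢₃
  ≤L-trans le₁₂ le₂₃ Γ φ = le₂₃ Γ φ ∘ le₁₂ Γ φ

  iter-++ : ∀ ⊢ b b' → iter S ⊢ (b ++ b') ≡ iter S (iter S ⊢ b) b'
  iter-++ ⊢ []      b' = refl
  iter-++ ⊢ (u ∷ b) b' = iter-++ (applyLR S u ⊢) b b'

  iter-preserves : (P : CRel S → Set₁) → (∀ u {⊢} → P ⊢ → P (applyLR S u ⊢)) →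
                   ∀ {⊢} b → P ⊢ → P (iter S ⊢ b)
  iter-preserves P step []      p = p
  iter-preserves P step (u ∷ b) p = iter-preserves P step b (step u p)

  noAntitheorem-anti : ∀ {⊢₁ ⊢₂} → _≤L_ S ⊢₁ ⊢₂ → NoAntitheorem ⊢₂ → NoAntitheorem ⊢₁
  noAntitheorem-anti le noAT (Σ' , anti) = noAT (Σ' , λ σ φ → le _ φ (anti σ φ))

  rOp-≤ : ∀ {⊢' ⊢} → _≤L_ S ⊢' ⊢ → NoAntitheorem ⊢ → _≤L_ S (rOp S ⊢') ⊢
  rOp-≤ le noAT Γ φ (inj₁ (⊢'φ , _))       = le Γ φ ⊢'φ
  rOp-≤ le noAT Γ φ (inj₂ (Σ' , anti , _)) =
    ⊥-elim (noAntitheorem-anti le noAT (Σ' , anti))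

  lOp-≤ : ∀ {⊢' ⊢} → _≤L_ S ⊢' ⊢ → Monotone ⊢ → _≤L_ S (lOp S ⊢') ⊢
  lOp-≤ le mono Γ φ (Δ , Δ⊆Γ , _ , ⊢'φ) = mono Δ⊆Γ (le Δ φ ⊢'φ)

  varExact-≤ : ∀ {⊢} → Monotone ⊢ → _≤L_ S (varExact ⊢) ⊢
  varExact-≤ mono Γ φ (Δ , Δ⊆Γ , ⊢φ , _) = mono Δ⊆Γ ⊢φ

  rl-≤-varExact : ∀ {⊢' ⊢} → _≤L_ S ⊢' ⊢ → NoAntitheorem ⊢ →
                  _≤L_ S (lOp S (rOp S ⊢')) (varExact ⊢)
  rl-≤-varExact le noAT Γ φ (Δ , Δ⊆Γ , VarΔ⊆ , inj₁ (⊢'φ , Var⊆Δ)) =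
    Δ , Δ⊆Γ , le Δ φ ⊢'φ , VarΔ⊆ , Var⊆Δ
  rl-≤-varExact le noAT Γ φ (_ , _ , _ , inj₂ (Σ' , anti , _)) =
    ⊥-elim (noAntitheorem-anti le noAT (Σ' , anti))

  varExact-≤-applyLR : ∀ {⊢} u {⊢'} → _≤L_ S (varExact ⊢) ⊢' →
                       _≤L_ S (varExact ⊢) (applyLR S u ⊢')
  varExact-≤-applyLR l le Γ φ (Δ , Δ⊆Γ , ⊢φ , VarΔ⊆ , Var⊆Δ) =
    Δ , Δ⊆Γ , VarΔ⊆ , le Δ φ (Δ , id , ⊢φ , VarΔ⊆ , Var⊆Δ)
  varExact-≤-applyLR r le Γ φ exact@(Δ , Δ⊆Γ , _ , _ , Var⊆Δ) =
    inj₁ (le Γ φ exact , λ x∈φ → let (γ , Δγ , x∈γ) = Var⊆Δ x∈φ in γ , Δ⊆Γ Δγ , x∈γ)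

  varExact-≤-iter : ∀ {⊢ ⊢'} b → _≤L_ S (varExact ⊢) ⊢' →
                    _≤L_ S (varExact ⊢) (iter S ⊢' b)
  varExact-≤-iter {⊢} = iter-preserves (λ ⊢' → _≤L_ S (varExact ⊢) ⊢') varExact-≤-applyLR

  module _ {⊢ : CRel S} (mono : Monotone ⊢) (noAT : NoAntitheorem ⊢) where

    iter-≤ : ∀ {⊢'} b → _≤L_ S ⊢' ⊢ → _≤L_ S (iter S ⊢' b) ⊢
    iter-≤ = iter-preserves (λ ⊢' → _≤L_ S ⊢' ⊢) step
      where
        step : ∀ u {⊢'} → _≤L_ S ⊢' ⊢ → _≤L_ S (applyLR S u ⊢') ⊢
        step l le = lOp-≤ le mono
        step r le = rOp-≤ le noAT

    iter-≤-varExact : ∀ {⊢'} b → _≤L_ S ⊢' (varExact ⊢) →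
                      _≤L_ S (iter S ⊢' b) (varExact ⊢)
    iter-≤-varExact = iter-preserves (λ ⊢' → _≤L_ S ⊢' (varExact ⊢)) step
      where
        varExact-mono : Monotone (varExact ⊢)
        varExact-mono Γ⊆Γ' (Δ , Δ⊆Γ , rest) = Δ , Γ⊆Γ' ∘ Δ⊆Γ , rest

        step : ∀ u {⊢'} → _≤L_ S ⊢' (varExact ⊢) → _≤L_ S (applyLR S u ⊢') (varExact ⊢)
        step l le = lOp-≤ le varExact-mono
        step r le = rOp-≤ le (noAntitheorem-anti (varExact-≤ mono) noAT)

corollary4p2 : (S : Signature) (⊢ : CRel S) →
    IsLogic S ⊢ → StandingAssumption S ⊢ →
    ¬ (Σ (Pred (Fm S) 0ℓ) λ Σ' → IsAntitheorem S ⊢ Σ') →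
    ((b b' : List (LR S)) (Γ : Pred (Fm S) 0ℓ) (φ : Fm S) →
    iter S ⊢ (b ++ (r ∷ l ∷ b')) Γ φ →
    Σ (Pred (Fm S) 0ℓ) λ Δ → Δ ⊆ Γ × ⊢ Δ φ ×
    VarSet S Δ ⊆ VarFm S φ × VarFm S φ ⊆ VarSet S Δ)
    × ((b : List (LR S)) → _≤L_ S (iter S ⊢ (r ∷ l ∷ [])) (iter S ⊢ b))
corollary4p2 S ⊢ isLogic _ noAT = partI , partII
  where
    mono : Monotone S ⊢
    mono = IsLogic.monotone isLogic

    partI : ∀ b b' → _≤L_ S (iter S ⊢ (b ++ (r ∷ l ∷ b'))) (varExact S ⊢)
    partI b b' Γ φ ⊢•φ = iter-≤-varExact S mono noAT b' rl-≤ Γ φ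
                           (subst (λ ⊢' → ⊢' Γ φ) (iter-++ S ⊢ b (r ∷ l ∷ b')) ⊢•φ)
      where
        rl-≤ : _≤L_ S (lOp S (rOp S (iter S ⊢ b))) (varExact S ⊢)
        rl-≤ = rl-≤-varExact S (iter-≤ S mono noAT b (≤L-refl S)) noAT

    partII : ∀ b → _≤L_ S (iter S ⊢ (r ∷ l ∷ [])) (iter S ⊢ b)
    partII b = ≤L-trans S (rl-≤-varExact S (≤L-refl S) noAT)
                          (varExact-≤-iter S b (varExact-≤ S mono))
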